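{- The property of having a fixed point (i.e., an index $i$ with $\pi_i=i$) is not expressible by an MSO sentence in \textsf{TOTO}; that is, there is no MSO sentence $\varphi$ over the signature $\{<_1,<_2\}$ such that for every permutation $\pi$, $\pi\models\varphi$ if and only if $\pi$ has a fixed point.
   Context: A permutation $\pi$ of $[n]$ is identified with its diagram $S_\pi=\{(i,\pi_i)\}$ and viewed as the structure $(S_\pi,\prec_1,\prec_2)$, where the binary symbols $<_1,<_2$ are interpreted as the orders of points by $x$- and $y$-coordinate respectively (\textsf{TOTO}: the theory stating both are linear orders). MSO formulas allow quantification over elements and over sets of elements, with membership atoms $x\in X$. -}

module Defs where

open import Data.Nat using (ℕ; zero; suc)
open import Data.Fin using (Fin; _<_)
open import Data.Fin.Subset using (Subset; _∈_)
open import Data.Fin.Permutation using (Permutation′; _⟨$⟩ʳ_)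
open import Data.Product using (Σ; _×_)
open import Data.Empty using (⊥)
open import Relation.Binary.PropositionalEquality using (_≡_)
open import Relation.Nullary using (¬_)

-- MSO formulas over the signature {<₁, <₂} (plus equality), with
-- k free element variables (Fin k) and m free set variables (Fin m),
-- in de Bruijn style.
data Formula : ℕ → ℕ → Set where
  _<₁_ : ∀ {k m} → Fin k → Fin k → Formula k m
  _<₂_ : ∀ {k m} → Fin k → Fin k → Formula k m
  _≐_  : ∀ {k m} → Fin k → Fin k → Formula k m
  _∈̇_  : ∀ {k m} → Fin k → Fin m → Formula k m
  ¬̇_   : ∀ {k m} → Formula k m → Formula k m
  _∧̇_  : ∀ {k m} → Formula k m → Formula k m → Formula k m
  ∃₁   : ∀ {k m} → Formula (suc k) m → Formula k m
  ∃₂   : ∀ {k m} → Formula k (suc m) → Formula k m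

Sentence : Set
Sentence = Formula 0 0

_▸_ : ∀ {k} {A : Set} → (Fin k → A) → A → Fin (suc k) → A
(ρ ▸ a) Fin.zero    = a
(ρ ▸ a) (Fin.suc i) = ρ i

-- The structure (S_π, ≺₁, ≺₂): the point (i, π i) is represented by the index i;
-- ≺₁ compares x-coordinates (i), ≺₂ compares y-coordinates (π i).
Sat : ∀ {n k m} → Permutation′ n → Formula k m
    → (Fin k → Fin n) → (Fin m → Subset n) → Set
Sat π (x <₁ y) ρ σ = ρ x < ρ y
Sat π (x <₂ y) ρ σ = (π ⟨$⟩ʳ ρ x) < (π ⟨$⟩ʳ ρ y)
Sat π (x ≐ y)  ρ σ = ρ x ≡ ρ y
Sat π (x ∈̇ X)  ρ σ = ρ x ∈ σ X
Sat π (¬̇ φ)    ρ σ = ¬ Sat π φ ρ σ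
Sat π (φ ∧̇ ψ)  ρ σ = Sat π φ ρ σ × Sat π ψ ρ σ
Sat {n} π (∃₁ φ) ρ σ = Σ (Fin n) λ a → Sat π φ (ρ ▸ a) σ
Sat {n} π (∃₂ φ) ρ σ = Σ (Subset n) λ A → Sat π φ ρ (σ ▸ A)

_⊨_ : ∀ {n} → Permutation′ n → Sentence → Set
π ⊨ φ = Sat π φ (λ ()) (λ ())

HasFixedPoint : ∀ {n} → Permutation′ n → Set
HasFixedPoint {n} π = Σ (Fin n) λ i → π ⟨$⟩ʳ i ≡ i

-- The permutation ι_a ⊖ ι_1 ⊖ ι_b (an increasing run of length a, above the single point (a, b),
-- above an increasing run of length b) has a fixed point iff a = b. It is MSO-interpretable in the
-- word 0ᵃ 1 2ᵇ: its x-order is the order of positions, and its y-order agrees with that order inside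
-- a block and reverses it across blocks. So an MSO sentence defining "has a fixed point" would give,
-- by Büchi's theorem, a finite automaton accepting 0ᵃ 1 2ᵇ iff a = b. By pigeonhole it reaches the
-- same state after 0ⁱ and after 0ʲ for some i < j, so it accepts 0ʲ 1 2ⁱ along with 0ⁱ 1 2ⁱ.

{-# OPTIONS --safe #-}
module Submission where

open import Data.Bool using (Bool; true; false; T; not; _∧_; _∨_; if_then_else_)
open import Data.Bool.Properties using (T-∧; T-∨; T-≡)
open import Data.Empty using (⊥-elim)
open import Data.Fin as Fin using (Fin; zero; suc; toℕ; fromℕ<; combine; remQuot; splitAt)
open import Data.Fin.Patterns using (0F; 1F; 2F)
import Data.Fin.Properties as Finₚ
open import Data.Fin.Permutation using (Permutation′; _⟨$⟩ʳ_; permutation)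
open import Data.Fin.Subset using (Subset; _∈_)
open import Data.Nat as ℕ using (ℕ; zero; suc; _+_; _*_; _<_; z<s; s<s; s<s⁻¹)
open import Data.Nat.Properties
  using (n<1+n; m≤n+m; m≤m+n; m<m+n; m+n≮m; +-comm; +-suc; +-identityʳ; +-monoˡ-≤; +-monoʳ-<;
         +-cancelˡ-<; <-irrefl; <-asym; <-trans; ≤-<-trans; <-≤-trans; module ≤-Reasoning)
open import Data.Product using (Σ; ∃; _×_; _,_; proj₁; proj₂; uncurry; map)
open import Data.Product.Function.NonDependent.Propositional using (_×-⇔_)
open import Data.Sum using (_⊎_; inj₁; inj₂; [_,_])
open import Data.Sum.Function.Propositional using (_⊎-⇔_)
open import Data.Vec using (Vec; []; _∷_; lookup; tabulate; uncons)
open import Data.Vec.Properties using (lookup∘tabulate; []=↔lookup)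
open import Data.Vec.Functional as Vector using (Vector; foldl; zip; replicate; _++_; head; tail)
open import Function using (id; _∘_; const)
open import Function.Bundles using (_⇔_; mk⇔; Equivalence; Inverse)
open import Function.Construct.Composition using (_⇔-∘_)
open import Function.Construct.Identity using (⇔-id)
open import Function.Construct.Symmetry using (⇔-sym)
open import Function.Properties.Inverse using (↔⇒⇔)
open import Function.Related.Propositional using (module EquationalReasoning; equivalence)
open import Function.Related.TypeIsomorphisms using (⊎-assoc; ¬-cong-⇔)
open import Level using (0ℓ)
open import Relation.Binary.Definitions using (DecidableEquality; tri<; tri≈; tri>)
open import Relation.Binary.PropositionalEquality
  using (_≡_; _≢_; refl; sym; trans; cong; cong₂; subst; subst₂; module ≡-Reasoning)
open import Relation.Nullary using (¬_; Dec; yes; no)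
open import Relation.Nullary.Decidable as Dec
  using (⌊_⌋; True; toWitness; fromWitness; _×-dec_; decidable-stable; T?)
open import Relation.Unary using (Pred; Decidable)
open import Defs

open Equivalence using (to; from)

private variable
  A B : Set
  k m n r : ℕ

True⇔ : {P : Set} {d : Dec P} → True d ⇔ P
True⇔ = mk⇔ toWitness fromWitness

⇔-by-cases : ∀ {P Q R S : Set} → Dec S → (S → P ⇔ Q) → (¬ S → P ⇔ R) → P ⇔ (Q × S ⊎ R × ¬ S)
⇔-by-cases (yes s) P⇔Q _ =
  mk⇔ (λ p → inj₁ (to (P⇔Q s) p , s)) [ from (P⇔Q s) ∘ proj₁ , (λ (_ , ¬s) → ⊥-elim (¬s s)) ]
⇔-by-cases (no ¬s) _ P⇔R =
  mk⇔ (λ p → inj₂ (to (P⇔R ¬s) p , ¬s)) [ (λ (_ , s) → ⊥-elim (¬s s)) , from (P⇔R ¬s) ∘ proj₁ ]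

T-not : ∀ {b} → T (not b) ⇔ (¬ T b)
T-not {true}  = mk⇔ (λ ()) (λ ¬t → ¬t _)
T-not {false} = mk⇔ (λ _ ()) (const _)

∈⇔T-lookup : ∀ {p : Fin n} {S : Subset n} → p ∈ S ⇔ T (lookup S p)
∈⇔T-lookup = ⇔-sym T-≡ ⇔-∘ ↔⇒⇔ []=↔lookup

∈-tabulate : ∀ (X : Vector Bool n) p → p ∈ tabulate X ⇔ T (X p)
∈-tabulate X p = subst (λ b → p ∈ tabulate X ⇔ T b) (lookup∘tabulate X p) ∈⇔T-lookup

-- Finite types

record Finite (A : Set) : Set where
  field
    size          : ℕ
    decode        : Fin size → A
    encode        : A → Fin size
    decode-encode : ∀ x → decode (encode x) ≡ x

  encode-injective : ∀ {x y} → encode x ≡ encode y → x ≡ y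
  encode-injective {x} {y} eq = begin
    x                 ≡⟨ decode-encode x ⟨
    decode (encode x) ≡⟨ cong decode eq ⟩
    decode (encode y) ≡⟨ decode-encode y ⟩
    y                 ∎
    where open ≡-Reasoning

  infix 4 _≟_
  _≟_ : DecidableEquality A
  x ≟ y = Dec.map′ encode-injective (cong encode) (encode x Fin.≟ encode y)

  any? : {P : Pred A 0ℓ} → Decidable P → Dec (∃ P)
  any? {P} P? = Dec.map′ (map decode id) (λ (x , px) → encode x , subst P (sym (decode-encode x)) px)
                         (Finₚ.any? (P? ∘ decode))

  pigeonhole : (f : ℕ → A) → ∃ λ i → ∃ λ j → i ℕ.< j × f i ≡ f j
  pigeonhole f with i , j , i<j , eq ← Finₚ.pigeonhole (n<1+n size) (encode ∘ f ∘ toℕ)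
    = toℕ i , toℕ j , i<j , encode-injective eq

finite-retract : Finite A → (f : A → B) (g : B → A) → (∀ y → f (g y) ≡ y) → Finite B
finite-retract F f g fg = record
  { size          = size
  ; decode        = f ∘ decode
  ; encode        = encode ∘ g
  ; decode-encode = λ y → trans (cong f (decode-encode (g y))) (fg y)
  } where open Finite F

finite-Fin : ∀ n → Finite (Fin n)
finite-Fin n = record { size = n ; decode = id ; encode = id ; decode-encode = λ _ → refl }

finite-Bool : Finite Bool
finite-Bool = finite-retract (finite-Fin 2) 2↔Bool.to 2↔Bool.from 2↔Bool.strictlyInverseˡ
  where module 2↔Bool = Inverse Finₚ.2↔Bool

finite-× : Finite A → Finite B → Finite (A × B)
finite-× F G = record
  { size          = F.size * G.size
  ; decode        = map F.decode G.decode ∘ remQuot G.size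
  ; encode        = uncurry combine ∘ map F.encode G.encode
  ; decode-encode = λ (x , y) →
      trans (cong (map F.decode G.decode) (Finₚ.remQuot-combine (F.encode x) (G.encode y)))
            (cong₂ _,_ (F.decode-encode x) (G.decode-encode y))
  } where module F = Finite F; module G = Finite G

finite-Vec : Finite A → ∀ n → Finite (Vec A n)
finite-Vec F zero    = finite-retract (finite-Fin 1) (const []) (const zero) λ { [] → refl }
finite-Vec F (suc n) =
  finite-retract (finite-× F (finite-Vec F n)) (uncurry _∷_) uncons λ { (_ ∷ _) → refl }

-- Monadic second-order logic on finite words, and Büchi's theorem

infix  4 _⊨ʷ_
infix  7 _≺_
infixr 6 _∧ʷ_
infixr 5 _∨ʷ_
infix  8 ¬ʷ_

-- A free set variable is a Bool component of the letters, so ∃ˢ passes from the alphabet A to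
-- Bool × A.
data WordFormula : Set → Set₁ where
  some : (A → Bool) → WordFormula A
  _≺_  : (A → Bool) → (A → Bool) → WordFormula A
  ¬ʷ_  : WordFormula A → WordFormula A
  _∧ʷ_ : WordFormula A → WordFormula A → WordFormula A
  _∨ʷ_ : WordFormula A → WordFormula A → WordFormula A
  ∃ˢ   : WordFormula (Bool × A) → WordFormula A

_⊨ʷ_ : Vector A n → WordFormula A → Set
w ⊨ʷ some P   = ∃ λ p → T (P (w p))
w ⊨ʷ P ≺ Q    = ∃ λ p → ∃ λ q → p Fin.< q × T (P (w p)) × T (Q (w q))
w ⊨ʷ ¬ʷ ψ     = ¬ (w ⊨ʷ ψ)
w ⊨ʷ ψ ∧ʷ χ   = w ⊨ʷ ψ × w ⊨ʷ χ
w ⊨ʷ ψ ∨ʷ χ   = w ⊨ʷ ψ ⊎ w ⊨ʷ χ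
_⊨ʷ_ {n = n} w (∃ˢ ψ) = ∃ λ (X : Vector Bool n) → zip X w ⊨ʷ ψ

record DFA (A : Set) : Set₁ where
  field
    State     : Set
    finite    : Finite State
    start     : State
    step      : State → A → State
    accepting : State → Bool

  run : State → Vector A n → State
  run s w = foldl step s w

  AcceptsFrom : State → Vector A n → Set
  AcceptsFrom s w = T (accepting (run s w))

  Accepts : Vector A n → Set
  Accepts = AcceptsFrom start

infix 4 _Recognises_
_Recognises_ : DFA A → WordFormula A → Set
D Recognises ψ = ∀ {n} (w : Vector _ n) → w ⊨ʷ ψ ⇔ DFA.Accepts D w

module _ {A : Set} (D : DFA A) where
  open DFA D

  run-cong : ∀ s {u v : Vector A n} → (∀ p → u p ≡ v p) → run s u ≡ run s v
  run-cong {n = zero}  s u≗v = refl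
  run-cong {n = suc n} s u≗v rewrite u≗v zero = run-cong _ (u≗v ∘ suc)

  run-++ : ∀ s (u : Vector A m) (v : Vector A n) → run s (u ++ v) ≡ run (run s u) v
  run-++ {m = zero}  s u v = refl
  run-++ {m = suc m} s u v = trans (run-cong _ tail-++) (run-++ _ (tail u) v)
    where
    tail-++ : ∀ p → tail (u ++ v) p ≡ (tail u ++ v) p
    tail-++ p with Fin.splitAt m p
    ... | inj₁ _ = refl
    ... | inj₂ _ = refl

  Accepts-++ : ∀ (u : Vector A m) (v : Vector A n) → Accepts (u ++ v) ≡ AcceptsFrom (run start u) v
  Accepts-++ u v = cong (T ∘ accepting) (run-++ start u v)

  prefix-pumping : ∀ (c : A) → ∃ λ i → ∃ λ j → i ℕ.< j ×
                   ∀ {n} (v : Vector A n) → Accepts (replicate i c ++ v) ⇔ Accepts (replicate j c ++ v)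
  prefix-pumping c with i , j , i<j , same ← Finite.pigeonhole finite (λ i → run start (replicate i c))
    = i , j , i<j , λ v → begin
      Accepts (replicate i c ++ v)              ≡⟨ Accepts-++ (replicate i c) v ⟩
      AcceptsFrom (run start (replicate i c)) v ≡⟨ cong (λ s → AcceptsFrom s v) same ⟩
      AcceptsFrom (run start (replicate j c)) v ≡⟨ sym (Accepts-++ (replicate j c) v) ⟩
      Accepts (replicate j c ++ v)              ∎
    where open EquationalReasoning {k = equivalence}

someᴰ : (A → Bool) → DFA A
someᴰ P = record
  { State = Bool ; finite = finite-Bool ; start = false ; step = λ s a → s ∨ P a ; accepting = id }

someᴰ-recognises : ∀ (P : A → Bool) → someᴰ P Recognises some P
someᴰ-recognises P w =
  mk⇔ (from (run-some false w) ∘ inj₂) ([ (λ ()) , id ] ∘ to (run-some false w))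
  where
  open DFA (someᴰ P)
  run-some : ∀ s (w : Vector _ n) → T (run s w) ⇔ (T s ⊎ w ⊨ʷ some P)
  run-some {n = zero}  s w = mk⇔ inj₁ [ id , (λ ()) ]
  run-some {n = suc n} s w = begin
    T (run (s ∨ P (head w)) (tail w))                  ∼⟨ run-some _ (tail w) ⟩
    (T (s ∨ P (head w)) ⊎ tail w ⊨ʷ some P)            ∼⟨ T-∨ ⊎-⇔ ⇔-id _ ⟩
    ((T s ⊎ T (P (head w))) ⊎ tail w ⊨ʷ some P)        ↔⟨ ⊎-assoc 0ℓ _ _ _ ⟩
    (T s ⊎ (T (P (head w)) ⊎ tail w ⊨ʷ some P))        ∼⟨ ⇔-id _ ⊎-⇔ Finₚ.⊎⇔∃ ⟩
    (T s ⊎ w ⊨ʷ some P)                                ∎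
    where open EquationalReasoning {k = equivalence}

data Phase : Set where
  seekingP seekingQ found : Phase

finite-Phase : Finite Phase
finite-Phase = record { size = 3 ; decode = decode ; encode = encode ; decode-encode = decode-encode }
  where
  decode : Fin 3 → Phase
  decode 0F = seekingP
  decode 1F = seekingQ
  decode 2F = found
  encode : Phase → Fin 3
  encode seekingP = 0F
  encode seekingQ = 1F
  encode found    = 2F
  decode-encode : ∀ x → decode (encode x) ≡ x
  decode-encode seekingP = refl
  decode-encode seekingQ = refl
  decode-encode found    = refl

precedesᴰ : (A → Bool) → (A → Bool) → DFA A
precedesᴰ P Q = record
  { State     = Phase
  ; finite    = finite-Phase
  ; start     = seekingP
  ; step      = step
  ; accepting = λ { found → true ; _ → false }
  } where
  step : Phase → _ → Phase
  step seekingP a = if P a then seekingQ else seekingP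
  step seekingQ a = if Q a then found else seekingQ
  step found    a = found

precedesᴰ-recognises : ∀ (P Q : A → Bool) → precedesᴰ P Q Recognises P ≺ Q
precedesᴰ-recognises P Q w = ⇔-sym (accepts-seekingP w)
  where
  open DFA (precedesᴰ P Q)

  accepts-found : ∀ (w : Vector _ n) → AcceptsFrom found w
  accepts-found {n = zero}  w = _
  accepts-found {n = suc n} w = accepts-found (tail w)

  accepts-seekingQ : ∀ (w : Vector _ n) → AcceptsFrom seekingQ w ⇔ ∃ λ q → T (Q (w q))
  accepts-seekingQ {n = zero}  w = mk⇔ (λ ()) (λ ())
  accepts-seekingQ {n = suc n} w = Finₚ.⊎⇔∃ ⇔-∘ first-letter
    where
    first-letter : AcceptsFrom seekingQ w ⇔ (T (Q (head w)) ⊎ ∃ λ q → T (Q (tail w q)))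
    first-letter with Q (head w)
    ... | true  = mk⇔ (const (inj₁ _)) (const (accepts-found (tail w)))
    ... | false = mk⇔ (inj₂ ∘ to (accepts-seekingQ (tail w)))
                      [ (λ ()) , from (accepts-seekingQ (tail w)) ]

  accepts-seekingP : ∀ (w : Vector _ n) → AcceptsFrom seekingP w ⇔ w ⊨ʷ P ≺ Q
  accepts-seekingP {n = zero}  w = mk⇔ (λ ()) (λ ())
  accepts-seekingP {n = suc n} w with P (head w) in P₀
  ... | true  = mk⇔ (later ∘ to (accepts-seekingQ (tail w))) (from (accepts-seekingQ (tail w)) ∘ some-Q)
    where
    later : (∃ λ q → T (Q (tail w q))) → w ⊨ʷ P ≺ Q
    later (q , Qq) = zero , suc q , z<s , subst T (sym P₀) _ , Qq
    some-Q : w ⊨ʷ P ≺ Q → ∃ λ q → T (Q (tail w q))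
    some-Q (_ , suc q , _ , _ , Qq) = q , Qq
  ... | false = mk⇔ (shift ∘ to (accepts-seekingP (tail w)))
                    (from (accepts-seekingP (tail w)) ∘ unshift)
    where
    shift : tail w ⊨ʷ P ≺ Q → w ⊨ʷ P ≺ Q
    shift (p , q , p<q , Pp , Qq) = suc p , suc q , s<s p<q , Pp , Qq
    unshift : w ⊨ʷ P ≺ Q → tail w ⊨ʷ P ≺ Q
    unshift (zero  , _     , _         , Pp , _ ) = ⊥-elim (subst T P₀ Pp)
    unshift (suc p , suc q , s<s p<q , Pp , Qq) = p , q , p<q , Pp , Qq

complementᴰ : DFA A → DFA A
complementᴰ D = record D { accepting = not ∘ DFA.accepting D }

complementᴰ-recognises : ∀ (D : DFA A) {ψ} → D Recognises ψ → complementᴰ D Recognises ¬ʷ ψ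
complementᴰ-recognises D D-ψ w = ⇔-sym T-not ⇔-∘ ¬-cong-⇔ (D-ψ w)

productᴰ : (Bool → Bool → Bool) → DFA A → DFA A → DFA A
productᴰ _∙_ D E = record
  { State     = D.State × E.State
  ; finite    = finite-× D.finite E.finite
  ; start     = D.start , E.start
  ; step      = λ (s , t) a → D.step s a , E.step t a
  ; accepting = λ (s , t) → D.accepting s ∙ E.accepting t
  } where module D = DFA D; module E = DFA E

run-productᴰ : ∀ _∙_ (D E : DFA A) s t (w : Vector A n) →
               DFA.run (productᴰ _∙_ D E) (s , t) w ≡ (DFA.run D s w , DFA.run E t w)
run-productᴰ {n = zero}  _∙_ D E s t w = refl
run-productᴰ {n = suc n} _∙_ D E s t w = run-productᴰ _∙_ D E _ _ (tail w)

productᴰ-∧-recognises : ∀ (D E : DFA A) {ψ χ} → D Recognises ψ → E Recognises χ →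
                        productᴰ _∧_ D E Recognises ψ ∧ʷ χ
productᴰ-∧-recognises D E D-ψ E-χ w
  rewrite run-productᴰ _∧_ D E (DFA.start D) (DFA.start E) w =
    ⇔-sym T-∧ ⇔-∘ (D-ψ w ×-⇔ E-χ w)

productᴰ-∨-recognises : ∀ (D E : DFA A) {ψ χ} → D Recognises ψ → E Recognises χ →
                        productᴰ _∨_ D E Recognises ψ ∨ʷ χ
productᴰ-∨-recognises D E D-ψ E-χ w
  rewrite run-productᴰ _∨_ D E (DFA.start D) (DFA.start E) w =
    ⇔-sym T-∨ ⇔-∘ (D-ψ w ⊎-⇔ E-χ w)

-- Sets of states are stored as subsets of the codes Fin size, which makes them a finite type again.
-- As decode need not be injective, a state belongs to such a set if one of its codes does.
module SubsetConstruction {A : Set} (D : DFA (Bool × A)) where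
  open DFA D
  open Finite finite

  _∋_ : Subset size → State → Set
  Q ∋ s = ∃ λ i → T (lookup Q i) × decode i ≡ s

  _∋?_ : ∀ Q → Decidable (Q ∋_)
  Q ∋? s = Finₚ.any? λ i → T? (lookup Q i) ×-dec (decode i ≟ s)

  ⟦_⟧ : {P : Pred State 0ℓ} → Decidable P → Subset size
  ⟦ P? ⟧ = tabulate (⌊_⌋ ∘ P? ∘ decode)

  ∋-⟦⟧ : ∀ {P} (P? : Decidable P) {s} → ⟦ P? ⟧ ∋ s ⇔ P s
  ∋-⟦⟧ {P} P? {s} = mk⇔
    (λ { (i , i∈ , refl) → toWitness (subst T (lookup∘tabulate _ i) i∈) })
    (λ Ps → encode s
          , subst T (sym (lookup∘tabulate _ (encode s)))
                    (fromWitness (subst P (sym (decode-encode s)) Ps))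
          , decode-encode s)

  Successor : Subset size → A → Pred State 0ℓ
  Successor Q a t = ∃ λ s → Q ∋ s × ∃ λ b → step s (b , a) ≡ t

  successor? : ∀ Q a → Decidable (Successor Q a)
  successor? Q a t = any? λ s → (Q ∋? s) ×-dec Finite.any? finite-Bool (λ b → step s (b , a) ≟ t)

  post : Subset size → A → Subset size
  post Q a = ⟦ successor? Q a ⟧

  ∋-post : ∀ Q a {t} → post Q a ∋ t ⇔ Successor Q a t
  ∋-post Q a = ∋-⟦⟧ (successor? Q a)

  Reachable : Subset size → Vector A n → Pred State 0ℓ
  Reachable Q w t = ∃ λ s → Q ∋ s × ∃ λ X → run s (zip X w) ≡ t

  Reachable-post : ∀ Q (w : Vector A (suc n)) {t} → Reachable (post Q (head w)) (tail w) t ⇔ Reachable Q w t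
  Reachable-post Q w {t} = mk⇔ guess-first-bit forget-first-bit
    where
    guess-first-bit : Reachable (post Q (head w)) (tail w) t → Reachable Q w t
    guess-first-bit (s′ , ∋s′ , X , eq) with s , Q∋s , b , refl ← to (∋-post Q (head w)) ∋s′ =
      s , Q∋s , b Vector.∷ X , eq
    forget-first-bit : Reachable Q w t → Reachable (post Q (head w)) (tail w) t
    forget-first-bit (s , Q∋s , X , eq) =
      step s (head X , head w) , from (∋-post Q (head w)) (s , Q∋s , head X , refl) , tail X , eq

  ∋-run-post : ∀ Q (w : Vector A n) {t} → foldl post Q w ∋ t ⇔ Reachable Q w t
  ∋-run-post {n = zero}  Q w {t} =
    mk⇔ (λ Q∋t → t , Q∋t , (λ ()) , refl) λ { (_ , Q∋s , _ , refl) → Q∋s }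
  ∋-run-post {n = suc n} Q w     = Reachable-post Q w ⇔-∘ ∋-run-post (post Q (head w)) (tail w)

  projectᴰ : DFA A
  projectᴰ = record
    { State     = Subset size
    ; finite    = finite-Vec finite-Bool size
    ; start     = ⟦ _≟ start ⟧
    ; step      = post
    ; accepting = λ Q → ⌊ any? (λ s → (Q ∋? s) ×-dec T? (accepting s)) ⌋
    }

  projectᴰ-recognises : ∀ {ψ} → D Recognises ψ → projectᴰ Recognises ∃ˢ ψ
  projectᴰ-recognises D-ψ w = mk⇔ accept reject
    where
    start∋ : ∀ {s} → DFA.start projectᴰ ∋ s ⇔ s ≡ start
    start∋ = ∋-⟦⟧ (_≟ start)
    accept : w ⊨ʷ ∃ˢ _ → DFA.Accepts projectᴰ w
    accept (X , sat) = fromWitness (run start (zip X w)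
      , from (∋-run-post _ w) (start , from start∋ refl , X , refl)
      , to (D-ψ (zip X w)) sat)
    reject : DFA.Accepts projectᴰ w → w ⊨ʷ ∃ˢ _
    reject acc with t , ∋t , acc-t ← toWitness acc
               with s , start∋s , X , refl ← to (∋-run-post _ w) ∋t
               with refl ← to start∋ start∋s
      = X , from (D-ψ (zip X w)) acc-t

open SubsetConstruction using (projectᴰ; projectᴰ-recognises)

compile : WordFormula A → DFA A
compile (some P)  = someᴰ P
compile (P ≺ Q)   = precedesᴰ P Q
compile (¬ʷ ψ)    = complementᴰ (compile ψ)
compile (ψ ∧ʷ χ)  = productᴰ _∧_ (compile ψ) (compile χ)
compile (ψ ∨ʷ χ)  = productᴰ _∨_ (compile ψ) (compile χ)
compile (∃ˢ ψ)    = projectᴰ (compile ψ)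

compile-recognises : ∀ (ψ : WordFormula A) → compile ψ Recognises ψ
compile-recognises (some P) = someᴰ-recognises P
compile-recognises (P ≺ Q)  = precedesᴰ-recognises P Q
compile-recognises (¬ʷ ψ)   = complementᴰ-recognises (compile ψ) (compile-recognises ψ)
compile-recognises (ψ ∧ʷ χ) =
  productᴰ-∧-recognises (compile ψ) (compile χ) (compile-recognises ψ) (compile-recognises χ)
compile-recognises (ψ ∨ʷ χ) =
  productᴰ-∨-recognises (compile ψ) (compile χ) (compile-recognises ψ) (compile-recognises χ)
compile-recognises (∃ˢ ψ)   = projectᴰ-recognises (compile ψ) (compile-recognises ψ)

-- Interpreting skew sums of increasing runs in words

infix 7 _⊆ʷ_

_⊆ʷ_ : (A → Bool) → (A → Bool) → WordFormula A
P ⊆ʷ Q = ¬ʷ some (λ a → P a ∧ not (Q a))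

singleton : (A → Bool) → WordFormula A
singleton P = some P ∧ʷ ¬ʷ (P ≺ P)

⋁ : (Fin r → WordFormula A) → WordFormula A
⋁ {r = zero}  ψ = some (const false)
⋁ {r = suc r} ψ = ψ zero ∨ʷ ⋁ (ψ ∘ suc)

ExactlyAt : (A → Bool) → Vector A n → Fin n → Set
ExactlyAt P w u = ∀ p → T (P (w p)) ⇔ p ≡ u

module _ {A : Set} (w : Vector A n) where

  ⊨-singleton : ∀ P → w ⊨ʷ singleton P ⇔ ∃ (ExactlyAt P w)
  ⊨-singleton P = mk⇔ (λ ((u , Pu) , ¬P≺P) → u , λ p → mk⇔ (unique ¬P≺P Pu) λ { refl → Pu })
                    (λ (u , P-at-u) → (u , from (P-at-u u) refl) , λ (p , q , p<q , Pp , Pq) →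
                      Finₚ.<-irrefl (trans (to (P-at-u p) Pp) (sym (to (P-at-u q) Pq))) p<q)
    where
    unique : ∀ {u p} → ¬ (w ⊨ʷ P ≺ P) → T (P (w u)) → T (P (w p)) → p ≡ u
    unique {u} {p} ¬P≺P Pu Pp with Finₚ.<-cmp p u
    ... | tri< p<u _ _ = ⊥-elim (¬P≺P (p , u , p<u , Pp , Pu))
    ... | tri≈ _ p≡u _ = p≡u
    ... | tri> _ _ u<p = ⊥-elim (¬P≺P (u , p , u<p , Pu , Pp))

  ⊨-⊆ʷ : ∀ P Q {u} → ExactlyAt P w u → w ⊨ʷ P ⊆ʷ Q ⇔ T (Q (w u))
  ⊨-⊆ʷ P Q {u} P-at-u = mk⇔
    (λ P⊆Q → decidable-stable (T? _) λ ¬Qu → P⊆Q (u , from T-∧ (from (P-at-u u) refl , from T-not ¬Qu)))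
    (λ Qu (p , PQp) → let (Pp , ¬Qp) = to T-∧ PQp in
      to T-not ¬Qp (subst (λ p → T (Q (w p))) (sym (to (P-at-u p) Pp)) Qu))

  ⊨-≺ : ∀ P Q {u v} → ExactlyAt P w u → ExactlyAt Q w v → w ⊨ʷ P ≺ Q ⇔ u Fin.< v
  ⊨-≺ P Q {u} {v} P-at-u Q-at-v = mk⇔
    (λ (p , q , p<q , Pp , Qq) → subst₂ Fin._<_ (to (P-at-u p) Pp) (to (Q-at-v q) Qq) p<q)
    (λ u<v → u , v , u<v , from (P-at-u u) refl , from (Q-at-v v) refl)

⊨-⋁ : ∀ (ψ : Fin r → WordFormula A) (w : Vector A n) → w ⊨ʷ ⋁ ψ ⇔ ∃ λ c → w ⊨ʷ ψ c
⊨-⋁ {r = zero}  ψ w = mk⇔ (λ ()) (λ ())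
⊨-⋁ {r = suc r} ψ w = Finₚ.⊎⇔∃ ⇔-∘ (⇔-id _ ⊎-⇔ ⊨-⋁ (ψ ∘ suc) w)

inBlock : (A → Fin r) → Fin r → A → Bool
inBlock β c a = ⌊ β a Fin.≟ c ⌋

sameBlock : (A → Fin r) → (A → Bool) → (A → Bool) → WordFormula A
sameBlock β P Q = ⋁ λ c → P ⊆ʷ inBlock β c ∧ʷ Q ⊆ʷ inBlock β c

⊨-sameBlock : ∀ (w : Vector A n) (β : A → Fin r) P Q {u v} → ExactlyAt P w u → ExactlyAt Q w v →
              w ⊨ʷ sameBlock β P Q ⇔ β (w u) ≡ β (w v)
⊨-sameBlock w β P Q {u} P-at-u Q-at-v = mk⇔
  (λ (c , Pc , Qc) → trans (toWitness (to (⊨-⊆ʷ w P (inBlock β c) P-at-u) Pc))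
                           (sym (toWitness (to (⊨-⊆ʷ w Q (inBlock β c) Q-at-v) Qc))))
  (λ same → β (w u) , from (⊨-⊆ʷ w P (inBlock β (β (w u))) P-at-u) (fromWitness refl)
            , from (⊨-⊆ʷ w Q (inBlock β (β (w u))) Q-at-v) (fromWitness (sym same)))
  ⇔-∘ ⊨-⋁ _ w

weaken : (Fin k → A → Bool) → Fin k → Bool × A → Bool
weaken ε x = ε x ∘ proj₂

-- ε and σ read the element and set variables off a letter, β its block. Element variables become
-- singleton set variables, and <₂ is the word order inside a block and its reverse across blocks.
translate : Formula k m → (Fin k → A → Bool) → (Fin m → A → Bool) → (A → Fin r) → WordFormula A
translate (x <₁ y) ε σ β = ε x ≺ ε y
translate (x <₂ y) ε σ β =
  ε x ≺ ε y ∧ʷ sameBlock β (ε x) (ε y) ∨ʷ ε y ≺ ε x ∧ʷ ¬ʷ sameBlock β (ε x) (ε y)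
translate (x ≐ y)  ε σ β = ε x ⊆ʷ ε y
translate (x ∈̇ X)  ε σ β = ε x ⊆ʷ σ X
translate (¬̇ φ)    ε σ β = ¬ʷ translate φ ε σ β
translate (φ ∧̇ ψ)  ε σ β = translate φ ε σ β ∧ʷ translate ψ ε σ β
translate (∃₁ φ)   ε σ β =
  ∃ˢ (singleton proj₁ ∧ʷ translate φ (weaken ε ▸ proj₁) (weaken σ) (β ∘ proj₂))
translate (∃₂ φ)   ε σ β = ∃ˢ (translate φ (weaken ε) (weaken σ ▸ proj₁) (β ∘ proj₂))

IsSkewSumOfRuns : Permutation′ n → (Fin n → Fin r) → Set
IsSkewSumOfRuns π block = ∀ p q →
  π ⟨$⟩ʳ p Fin.< π ⟨$⟩ʳ q ⇔ (p Fin.< q × block p ≡ block q ⊎ q Fin.< p × block p ≢ block q)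

module _ {π : Permutation′ n} {block : Fin n → Fin r} (skew-sum : IsSkewSumOfRuns π block) where

  translate-correct : ∀ {A k m} (φ : Formula k m) ε σ (β : A → Fin r) (w : Vector A n) {ρ S} →
    (∀ x → ExactlyAt (ε x) w (ρ x)) → (∀ X p → T (σ X (w p)) ⇔ p ∈ S X) →
    (∀ p → β (w p) ≡ block p) →
    Sat π φ ρ S ⇔ w ⊨ʷ translate φ ε σ β
  translate-correct (x <₁ y) ε σ β w ε-ok σ-ok β-ok = ⇔-sym (⊨-≺ w (ε x) (ε y) (ε-ok x) (ε-ok y))
  translate-correct (x <₂ y) ε σ β w {ρ} ε-ok σ-ok β-ok =
    ⇔-sym ((x≺y ×-⇔ same) ⊎-⇔ (y≺x ×-⇔ ¬-cong-⇔ same)) ⇔-∘ skew-sum (ρ x) (ρ y)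
    where
    x≺y : w ⊨ʷ ε x ≺ ε y ⇔ ρ x Fin.< ρ y
    x≺y = ⊨-≺ w (ε x) (ε y) (ε-ok x) (ε-ok y)
    y≺x : w ⊨ʷ ε y ≺ ε x ⇔ ρ y Fin.< ρ x
    y≺x = ⊨-≺ w (ε y) (ε x) (ε-ok y) (ε-ok x)
    same : w ⊨ʷ sameBlock β (ε x) (ε y) ⇔ block (ρ x) ≡ block (ρ y)
    same = subst₂ (λ b b′ → _ ⇔ b ≡ b′) (β-ok (ρ x)) (β-ok (ρ y))
                  (⊨-sameBlock w β (ε x) (ε y) (ε-ok x) (ε-ok y))
  translate-correct (x ≐ y)  ε σ β w {ρ} ε-ok σ-ok β-ok =
    ⇔-sym (ε-ok y (ρ x) ⇔-∘ ⊨-⊆ʷ w (ε x) (ε y) (ε-ok x))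
  translate-correct (x ∈̇ X)  ε σ β w {ρ} ε-ok σ-ok β-ok =
    ⇔-sym (σ-ok X (ρ x) ⇔-∘ ⊨-⊆ʷ w (ε x) (σ X) (ε-ok x))
  translate-correct (¬̇ φ)    ε σ β w ε-ok σ-ok β-ok =
    ¬-cong-⇔ (translate-correct φ ε σ β w ε-ok σ-ok β-ok)
  translate-correct (φ ∧̇ ψ)  ε σ β w ε-ok σ-ok β-ok =
    translate-correct φ ε σ β w ε-ok σ-ok β-ok ×-⇔ translate-correct ψ ε σ β w ε-ok σ-ok β-ok
  translate-correct (∃₁ φ)   ε σ β w {ρ} {S} ε-ok σ-ok β-ok = mk⇔
    (λ (u , sat) → let X = λ p → ⌊ p Fin.≟ u ⌋; X-at-u = λ p → True⇔ in
      X , from (⊨-singleton (zip X w) proj₁) (u , X-at-u) , to (IH X X-at-u) sat)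
    (λ (X , single , sat) → let (u , X-at-u) = to (⊨-singleton (zip X w) proj₁) single in
      u , from (IH X X-at-u) sat)
    where
    IH : ∀ {u} X → ExactlyAt proj₁ (zip X w) u →
         Sat π φ (ρ ▸ u) S ⇔ zip X w ⊨ʷ translate φ (weaken ε ▸ proj₁) (weaken σ) (β ∘ proj₂)
    IH X X-at-u = translate-correct φ _ _ _ (zip X w) (λ { zero → X-at-u ; (suc x) → ε-ok x }) σ-ok β-ok
  translate-correct (∃₂ φ)   ε σ β w {ρ} {S} ε-ok σ-ok β-ok = mk⇔
    (λ (Y , sat) → lookup Y , to (IH (lookup Y) Y (λ _ → ⇔-sym ∈⇔T-lookup)) sat)
    (λ (X , sat) → tabulate X , from (IH X (tabulate X) λ p → ⇔-sym (∈-tabulate X p)) sat)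
    where
    IH : ∀ X Y → (∀ p → T (X p) ⇔ p ∈ Y) →
         Sat π φ ρ (S ▸ Y) ⇔ zip X w ⊨ʷ translate φ (weaken ε) (weaken σ ▸ proj₁) (β ∘ proj₂)
    IH X Y X≈Y = translate-correct φ _ _ _ (zip X w) ε-ok (λ { zero → X≈Y ; (suc X) → σ-ok X }) β-ok

-- The permutations ι_a ⊖ ι_1 ⊖ ι_b

n<m+1+n : ∀ m n → n < m + suc n
n<m+1+n m n = ≤-<-trans (m≤n+m n m) (+-monoʳ-< m (n<1+n n))

+-suc-<-⇔ : ∀ m {i j} → m + suc i < m + suc j ⇔ i < j
+-suc-<-⇔ m = mk⇔ (s<s⁻¹ ∘ +-cancelˡ-< m _ _) (+-monoʳ-< m ∘ s<s)

data Segment (a : ℕ) : ℕ → Set where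
  before : ∀ {x} → x < a → Segment a x
  pivot  : Segment a a
  after  : ∀ k → Segment a (a + suc k)

segment : ∀ a x → Segment a x
segment zero    zero    = pivot
segment zero    (suc k) = after k
segment (suc a) zero    = before z<s
segment (suc a) (suc x) with segment a x
... | before x<a = before (s<s x<a)
... | pivot      = pivot
... | after k    = after k

segment-before : ∀ {a x} (x<a : x < a) → segment a x ≡ before x<a
segment-before {suc a} {zero}  z<s       = refl
segment-before {suc a} {suc x} (s<s x<a) rewrite segment-before x<a = refl

segment-pivot : ∀ a → segment a a ≡ pivot
segment-pivot zero    = refl
segment-pivot (suc a) rewrite segment-pivot a = refl

segment-after : ∀ a k → segment a (a + suc k) ≡ after k
segment-after zero    k = refl
segment-after (suc a) k rewrite segment-after a k = refl

block : ℕ → ℕ → Fin 3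
block a x with segment a x
... | before _ = 0F
... | pivot    = 1F
... | after _  = 2F

-- The inverse of ι_a ⊖ ι_1 ⊖ ι_b is ι_b ⊖ ι_1 ⊖ ι_a, so height b a inverts height a b.
height : ℕ → ℕ → ℕ → ℕ
height a b x with segment a x
... | before _ = b + suc x
... | pivot    = b
... | after k  = k

block-before : ∀ a {x} → x < a → block a x ≡ 0F
block-before a x<a rewrite segment-before x<a = refl

block-pivot : ∀ a → block a a ≡ 1F
block-pivot a rewrite segment-pivot a = refl

block-after : ∀ a k → block a (a + suc k) ≡ 2F
block-after a k rewrite segment-after a k = refl

height-before : ∀ a b {x} → x < a → height a b x ≡ b + suc x
height-before a b x<a rewrite segment-before x<a = refl

height-pivot : ∀ a b → height a b a ≡ b
height-pivot a b rewrite segment-pivot a = refl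

height-after : ∀ a b k → height a b (a + suc k) ≡ k
height-after a b k rewrite segment-after a k = refl

after-bound : ∀ a {b k} → a + suc k < a + suc b → k < b
after-bound a = to (+-suc-<-⇔ a)

height-< : ∀ a b {x} → x < a + suc b → height a b x < a + suc b
height-< a b {x} x< with segment a x
... | before x<a = begin-strict
  b + suc x  ≡⟨ +-comm b (suc x) ⟩
  suc x + b  ≤⟨ +-monoˡ-≤ b x<a ⟩
  a + b      <⟨ +-monoʳ-< a (n<1+n b) ⟩
  a + suc b  ∎
  where open ≤-Reasoning
... | pivot      = n<m+1+n a b
... | after k    = <-trans (after-bound a x<) (n<m+1+n a b)

height-inverse : ∀ a b {x} → x < a + suc b → height b a (height a b x) ≡ x
height-inverse a b {x} x< with segment a x
... | before _ = height-after b a x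
... | pivot    = height-pivot b a
... | after k  = height-before b a (after-bound a x<)

height-within-block : ∀ a b {x y} → block a x ≡ block a y → height a b x < height a b y ⇔ x < y
height-within-block a b {x} {y} same with segment a x | segment a y | same
  -- in the six missing cases, same equates two distinct blocks
... | before _ | before _ | _ = +-suc-<-⇔ b
... | pivot    | pivot    | _ = mk⇔ (⊥-elim ∘ <-irrefl refl) (⊥-elim ∘ <-irrefl refl)
... | after _  | after _  | _ = ⇔-sym (+-suc-<-⇔ a)

height-across-blocks : ∀ a b {x y} → x < a + suc b → y < a + suc b → block a x ≢ block a y →
                       height a b x < height a b y ⇔ y < x
height-across-blocks a b {x} {y} x< y< different with segment a x | segment a y
... | before x<a | before _   = ⊥-elim (different refl)
... | before x<a | pivot      = mk⇔ (⊥-elim ∘ m+n≮m b (suc x)) (λ a<x → ⊥-elim (<-asym a<x x<a))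
... | before x<a | after l    = mk⇔ (λ h → ⊥-elim (<-asym (≤-<-trans (m≤m+n b _) h) (after-bound a y<)))
                                    (λ h → ⊥-elim (<-asym (≤-<-trans (m≤m+n a _) h) x<a))
... | pivot      | before y<a = mk⇔ (const y<a) (const (m<m+n b z<s))
... | pivot      | pivot      = ⊥-elim (different refl)
... | pivot      | after l    = mk⇔ (λ b<l → ⊥-elim (<-asym b<l (after-bound a y<)))
                                    (⊥-elim ∘ m+n≮m a (suc l))
... | after k    | before y<a = mk⇔ (const (<-≤-trans y<a (m≤m+n a (suc k))))
                                    (const (<-≤-trans (after-bound a x<) (m≤m+n b (suc y))))
... | after k    | pivot      = mk⇔ (const (m<m+n a z<s)) (const (after-bound a x<))
... | after k    | after l    = ⊥-elim (different refl)

height-skew : ∀ a b {x y} → x < a + suc b → y < a + suc b →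
              height a b x < height a b y ⇔
              (x < y × block a x ≡ block a y ⊎ y < x × block a x ≢ block a y)
height-skew a b {x} {y} x< y< =
  ⇔-by-cases (block a x Fin.≟ block a y) (height-within-block a b) (height-across-blocks a b x< y<)

height-fixed⇒≡ : ∀ a b {x} → height a b x ≡ x → a ≡ b
height-fixed⇒≡ a b {x} fixed with segment a x | fixed
... | before _ | b+1+x≡x = ⊥-elim (<-irrefl (sym b+1+x≡x) (n<m+1+n b x))
... | pivot    | b≡a     = sym b≡a
... | after k  | k≡a+1+k = ⊥-elim (<-irrefl k≡a+1+k (n<m+1+n a k))

module _ {n : ℕ} where

  restrict : (f : ℕ → ℕ) → (∀ {x} → x < n → f x < n) → Fin n → Fin n
  restrict f f< p = fromℕ< (f< (Finₚ.toℕ<n p))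

  toℕ-restrict : ∀ f (f< : ∀ {x} → x < n → f x < n) p → toℕ (restrict f f< p) ≡ f (toℕ p)
  toℕ-restrict f f< p = Finₚ.toℕ-fromℕ< _

  restrict-inverse : ∀ f g (f< : ∀ {x} → x < n → f x < n) (g< : ∀ {x} → x < n → g x < n) →
                     (∀ {x} → x < n → f (g x) ≡ x) → ∀ p → restrict f f< (restrict g g< p) ≡ p
  restrict-inverse f g f< g< fg p = Finₚ.toℕ-injective (begin
    toℕ (restrict f f< (restrict g g< p)) ≡⟨ toℕ-restrict f f< _ ⟩
    f (toℕ (restrict g g< p))             ≡⟨ cong f (toℕ-restrict g g< p) ⟩
    f (g (toℕ p))                         ≡⟨ fg (Finₚ.toℕ<n p) ⟩
    toℕ p                                 ∎)
    where open ≡-Reasoning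

module _ (a b : ℕ) where

  private
    swap-size : a + suc b ≡ b + suc a
    swap-size = trans (+-suc a b) (trans (cong suc (+-comm a b)) (sym (+-suc b a)))

    height⁻¹-< : ∀ {x} → x < a + suc b → height b a x < a + suc b
    height⁻¹-< {x} x< = subst (height b a x <_) (sym swap-size) (height-< b a (subst (x <_) swap-size x<))

    height⁻¹-inverse : ∀ {x} → x < a + suc b → height a b (height b a x) ≡ x
    height⁻¹-inverse {x} x< = height-inverse b a (subst (x <_) swap-size x<)

  skew : Permutation′ (a + suc b)
  skew = permutation (restrict (height a b) (height-< a b)) (restrict (height b a) height⁻¹-<)
    (restrict-inverse _ _ (height-< a b) height⁻¹-< height⁻¹-inverse)
    (restrict-inverse _ _ height⁻¹-< (height-< a b) (height-inverse a b))

  toℕ-skew : ∀ p → toℕ (skew ⟨$⟩ʳ p) ≡ height a b (toℕ p)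
  toℕ-skew = toℕ-restrict (height a b) (height-< a b)

  skew-hasFixedPoint⇔ : HasFixedPoint skew ⇔ a ≡ b
  skew-hasFixedPoint⇔ = mk⇔
    (λ (p , fixed) → height-fixed⇒≡ a b (trans (sym (toℕ-skew p)) (cong toℕ fixed)))
    (λ a≡b → pivotᶠ , Finₚ.toℕ-injective (begin
      toℕ (skew ⟨$⟩ʳ pivotᶠ)  ≡⟨ toℕ-skew pivotᶠ ⟩
      height a b (toℕ pivotᶠ) ≡⟨ cong (height a b) (Finₚ.toℕ-fromℕ< _) ⟩
      height a b a            ≡⟨ height-pivot a b ⟩
      b                       ≡⟨ a≡b ⟨
      a                       ≡⟨ Finₚ.toℕ-fromℕ< _ ⟨
      toℕ pivotᶠ              ∎))
    where
    pivotᶠ : Fin (a + suc b)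
    pivotᶠ = fromℕ< (m<m+n a z<s)
    open ≡-Reasoning

  blocks : Fin (a + suc b) → Fin 3
  blocks = block a ∘ toℕ

  blockWord : Vector (Fin 3) (a + suc b)
  blockWord = replicate a 0F ++ (1F Vector.∷ replicate b 2F)

  blocks-++ : ∀ p → blocks p ≡ blockWord p
  blocks-++ p with splitAt a p in split
  ... | inj₁ i       = subst (λ q → blocks q ≡ 0F) (Finₚ.splitAt⁻¹-↑ˡ split)
    (trans (cong (block a) (Finₚ.toℕ-↑ˡ i (suc b))) (block-before a (Finₚ.toℕ<n i)))
  ... | inj₂ zero    = subst (λ q → blocks q ≡ 1F) (Finₚ.splitAt⁻¹-↑ʳ split)
    (trans (cong (block a) (trans (Finₚ.toℕ-↑ʳ a zero) (+-identityʳ a))) (block-pivot a))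
  ... | inj₂ (suc k) = subst (λ q → blocks q ≡ 2F) (Finₚ.splitAt⁻¹-↑ʳ split)
    (trans (cong (block a) (Finₚ.toℕ-↑ʳ a (suc k))) (block-after a (toℕ k)))

  skew-isSkewSumOfRuns : IsSkewSumOfRuns skew blocks
  skew-isSkewSumOfRuns p q rewrite toℕ-skew p | toℕ-skew q =
    height-skew a b (Finₚ.toℕ<n p) (Finₚ.toℕ<n q)

blockAutomaton : Sentence → DFA (Fin 3)
blockAutomaton φ = compile (translate φ (λ ()) (λ ()) id)

skew-⊨⇔accepts : ∀ φ a b → skew a b ⊨ φ ⇔ DFA.Accepts (blockAutomaton φ) (blockWord a b)
skew-⊨⇔accepts φ a b =
  compile-recognises (translate φ (λ ()) (λ ()) id) (blockWord a b)
  ⇔-∘ translate-correct (skew-isSkewSumOfRuns a b) φ (λ ()) (λ ()) id (blockWord a b)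
                        (λ ()) (λ ()) (sym ∘ blocks-++ a b)

proposition4 : ¬ (Σ Sentence λ φ → (n : ℕ) → (π : Permutation′ n) → ((π ⊨ φ) ⇔ HasFixedPoint π))
proposition4 (φ , defines) with i , j , i<j , indistinguishable ← prefix-pumping (blockAutomaton φ) 0F
  = <-irrefl (sym (to (skew-hasFixedPoint⇔ j i) (transfer (from (skew-hasFixedPoint⇔ i i) refl)))) i<j
  where
  transfer : HasFixedPoint (skew i i) → HasFixedPoint (skew j i)
  transfer = to (defines _ (skew j i)) ∘ from (skew-⊨⇔accepts φ j i)
           ∘ to (indistinguishable (1F Vector.∷ replicate i 2F))
           ∘ to (skew-⊨⇔accepts φ i i) ∘ from (defines _ (skew i i))
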